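{- The pomax game on a chess-colored tree poset is balanced.
   Context: A pomax game on a finite poset $P$ whose elements are colored black or white: White and Black alternately remove a maximal element (of the remaining subposet) of their own color; a player who cannot move loses. A tree poset is either empty or a finite poset in which every element except one (the root) covers exactly one element. A coloring is a chess coloring if no element covers an element of the same color. A position (a remaining set of elements, with the induced order and coloring) is balanced if (i) every position reachable from it in one move (by either player) is balanced, and (ii) whenever all its removable (here: maximal) elements are of the same color, at least half of its elements have that color. A colored poset is called balanced if its pomax game (starting position) is balanced. -}

module Defs where

open import Level using (0ℓ)
open import Data.Nat using (ℕ; _*_; _≤_)
open import Data.Bool using (Bool; true; false)
open import Data.Bool.Properties using () renaming (_≟_ to _≟B_)
open import Relation.Nullary using (does)
open import Data.Fin using (Fin)
open import Data.Fin.Subset using (Subset; _∈_; _∩_; _-_; ∣_∣; ⊤)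
open import Data.Vec using (tabulate)
open import Data.Product using (Σ; _×_; _,_)
open import Data.Sum using (_⊎_)
open import Relation.Binary using (Rel)
open import Relation.Binary.PropositionalEquality using (_≡_; _≢_)
open import Relation.Nullary using (¬_)

-- A finite poset is Fin n with a partial order _≼_ (IsPartialOrder _≡_ _≼_).
-- Colors are Bool (true = white, false = black, say).

module _ {n : ℕ} (_≼_ : Rel (Fin n) 0ℓ) where

  _≺_ : Rel (Fin n) 0ℓ
  x ≺ y = (x ≼ y) × (x ≢ y)

  Covers : Fin n → Fin n → Set
  Covers x y = (y ≺ x) × (¬ Σ (Fin n) (λ z → (y ≺ z) × (z ≺ x)))

  CoversExactlyOne : Fin n → Set
  CoversExactlyOne x = Σ (Fin n) (λ y → Covers x y × (∀ y′ → Covers x y′ → y′ ≡ y))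

  IsTree : Set
  IsTree = (n ≡ 0) ⊎ Σ (Fin n) (λ r → ∀ x → x ≢ r → CoversExactlyOne x)

  IsChess : (Fin n → Bool) → Set
  IsChess col = ∀ x y → Covers x y → col x ≢ col y

  Maximal : Subset n → Fin n → Set
  Maximal S x = (x ∈ S) × (∀ y → y ∈ S → ¬ (x ≺ y))

  module _ (col : Fin n → Bool) where

    ColorSet : Bool → Subset n
    ColorSet c = tabulate (λ x → does (col x ≟B c))

    AllMaxOfColor : Subset n → Bool → Set
    AllMaxOfColor S c = ∀ x → Maximal S x → col x ≡ c

    -- balanced positions (inductive; well-founded since each move shrinks S)
    data Balanced (S : Subset n) : Set where
      balanced :
        (∀ x → Maximal S x → Balanced (S - x)) →
        (∀ c → AllMaxOfColor S c → ∣ S ∣ ≤ 2 * ∣ S ∩ ColorSet c ∣) →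
        Balanced S

    BalancedPoset : Set
    BalancedPoset = Balanced ⊤

-- Every position reachable in the game is a down-set of the tree.  If all
-- maximal elements of a down-set S have color c, send each element v of S of
-- the other color to an element of S covering v: it exists because v is not
-- maximal, it has color c by the chess condition, and the map is injective
-- because in a tree an element covers at most one element.  Hence at most
-- half of S has the other color.
module Submission where

open import Defs
open import Level using (0ℓ)
open import Data.Nat using (ℕ; zero; suc; _+_; _*_; _≤_; z≤n; s≤s) renaming (_<_ to _<ℕ_)
open import Data.Nat.Properties using (_≤?_; +-suc; +-monoʳ-≤; +-identityʳ; suc-injective; module ≤-Reasoning)
open import Data.Nat.Induction using () renaming (<-wellFounded to <ℕ-wellFounded)
open import Data.Bool using (Bool; true; not)
open import Data.Bool.Properties using (¬-not; not-involutive) renaming (_≟_ to _≟B_)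
open import Data.Fin using (Fin; zero; suc) renaming (_≟_ to _≟F_)
open import Data.Fin.Properties using (any?; ¬Fin0; sequence)
open import Data.Fin.Induction using (po-wellFounded)
open import Data.Fin.Subset using (Subset; _∈_; _∉_; _∩_; _-_; ∣_∣; ∁; Nonempty; inside; outside)
open import Data.Fin.Subset.Properties using (_∈?_; ∈⊤; p─⊥≡p; p─q⊆p; x∈p∩q⁺; x∈p∩q⁻; x∈∁p⇒x∉p; x∈p∧x≢y⇒x∈p-y; x∈p⇒∣p-x∣<∣p∣; nonempty?; Empty-unique; ∣⊥∣≡0)
open import Data.Vec using ([]; _∷_; tabulate)
open import Data.Vec.Base using (here; there)
open import Data.Vec.Properties using (lookup⇒[]=; lookup∘tabulate)
open import Data.Product using (Σ; _×_; _,_; proj₁; proj₂)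
open import Data.Sum using (inj₁; inj₂)
open import Effect.Applicative using (RawApplicative)
open import Effect.Monad using (RawMonad)
open import Function using (_∘_; _on_)
open import Induction.WellFounded using (WellFounded; Acc; acc)
open import Relation.Binary using (Rel; IsPartialOrder; Decidable)
import Relation.Binary.Construct.NonStrictToStrict as ToStrict
open import Relation.Binary.Construct.On using () renaming (wellFounded to wellFounded-on)
open import Relation.Binary.PropositionalEquality using (_≡_; _≢_; refl; sym; trans; cong; subst; module ≡-Reasoning)
open import Relation.Nullary using (¬_; yes; no)
open import Relation.Nullary.Decidable using (dec-true; decidable-stable; _×-dec_; ¬¬-excluded-middle)
open import Relation.Nullary.Negation using (DoubleNegation; ¬¬-Monad; ¬¬-map; contradiction)

private
  variable
    n : ℕ

x∉p-x : ∀ (x : Fin n) p → x ∉ p - x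
x∉p-x zero    (_ ∷ p) ()
x∉p-x (suc x) (_ ∷ p) (there x∈p-x) = x∉p-x x p x∈p-x

x∈p-y⇒x≢y : ∀ {p : Subset n} {x y} → x ∈ p - y → x ≢ y
x∈p-y⇒x≢y {p = p} {x = x} x∈p-y refl = x∉p-x x p x∈p-y

x∈p⇒∣p∣≡1+∣p-x∣ : ∀ {p : Subset n} {x} → x ∈ p → ∣ p ∣ ≡ suc ∣ p - x ∣
x∈p⇒∣p∣≡1+∣p-x∣ {p = inside ∷ p} {zero}  here          = cong (suc ∘ ∣_∣) (sym (p─⊥≡p p))
x∈p⇒∣p∣≡1+∣p-x∣ {p = inside ∷ p} {suc x} (there x∈p)   = cong suc (x∈p⇒∣p∣≡1+∣p-x∣ x∈p)
x∈p⇒∣p∣≡1+∣p-x∣ {p = outside ∷ p} {suc x} (there x∈p)  = x∈p⇒∣p∣≡1+∣p-x∣ x∈p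

∣p∣≡∣p∩q∣+∣p∩∁q∣ : ∀ (p q : Subset n) → ∣ p ∣ ≡ ∣ p ∩ q ∣ + ∣ p ∩ ∁ q ∣
∣p∣≡∣p∩q∣+∣p∩∁q∣ []            []            = refl
∣p∣≡∣p∩q∣+∣p∩∁q∣ (inside ∷ p)  (inside ∷ q)  = cong suc (∣p∣≡∣p∩q∣+∣p∩∁q∣ p q)
∣p∣≡∣p∩q∣+∣p∩∁q∣ (inside ∷ p)  (outside ∷ q) = trans (cong suc (∣p∣≡∣p∩q∣+∣p∩∁q∣ p q)) (sym (+-suc _ _))
∣p∣≡∣p∩q∣+∣p∩∁q∣ (outside ∷ p) (_ ∷ q)       = ∣p∣≡∣p∩q∣+∣p∩∁q∣ p q

∣p∣≡1+k⇒Nonempty : ∀ {p : Subset n} {k} → ∣ p ∣ ≡ suc k → Nonempty p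
∣p∣≡1+k⇒Nonempty {n} {p} ∣p∣≡1+k with nonempty? p
... | yes p≢∅ = p≢∅
... | no  p≡∅ with () ← trans (sym ∣p∣≡1+k) (trans (cong ∣_∣ (Empty-unique p≡∅)) (∣⊥∣≡0 n))

x∈tabulate⁺ : ∀ (f : Fin n → Bool) {x} → f x ≡ true → x ∈ tabulate f
x∈tabulate⁺ f {x} fx≡true = lookup⇒[]= x (tabulate f) (trans (lookup∘tabulate f x) fx≡true)

record SubsetInjection (p q : Subset n) : Set where
  field
    to        : ∀ {x} → x ∈ p → Fin n
    to-∈      : ∀ {x} (x∈p : x ∈ p) → to x∈p ∈ q
    injective : ∀ {x y} (x∈p : x ∈ p) (y∈p : y ∈ p) → to x∈p ≡ to y∈p → x ≡ y

open SubsetInjection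

SubsetInjection-remove : ∀ {p q : Subset n} {x} (ι : SubsetInjection p q) (x∈p : x ∈ p) →
                         SubsetInjection (p - x) (q - to ι x∈p)
SubsetInjection-remove {p = p} {q} {x} ι x∈p = record
  { to        = λ y∈p-x → to ι (p-x⊆p y∈p-x)
  ; to-∈      = λ y∈p-x → x∈p∧x≢y⇒x∈p-y (to-∈ ι (p-x⊆p y∈p-x))
                  (λ ιy≡ιx → x∈p-y⇒x≢y y∈p-x (injective ι (p-x⊆p y∈p-x) x∈p ιy≡ιx))
  ; injective = λ y∈p-x z∈p-x → injective ι (p-x⊆p y∈p-x) (p-x⊆p z∈p-x)
  }
  where
  p-x⊆p : ∀ {y} → y ∈ p - x → y ∈ p
  p-x⊆p = p─q⊆p p _

SubsetInjection⇒∣p∣≤∣q∣ : ∀ {p q : Subset n} → SubsetInjection p q → ∣ p ∣ ≤ ∣ q ∣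
SubsetInjection⇒∣p∣≤∣q∣ = go refl
  where
  go : ∀ {k} {p q : Subset n} → ∣ p ∣ ≡ k → SubsetInjection p q → ∣ p ∣ ≤ ∣ q ∣
  go {k = zero} ∣p∣≡0 _ = subst (_≤ _) (sym ∣p∣≡0) z≤n
  go {k = suc k} {p} {q} ∣p∣≡1+k ι with ∣p∣≡1+k⇒Nonempty ∣p∣≡1+k
  ... | x , x∈p = begin
    ∣ p ∣                 ≡⟨ x∈p⇒∣p∣≡1+∣p-x∣ x∈p ⟩
    suc ∣ p - x ∣         ≤⟨ s≤s (go ∣p-x∣≡k (SubsetInjection-remove ι x∈p)) ⟩
    suc ∣ q - to ι x∈p ∣  ≡⟨ sym (x∈p⇒∣p∣≡1+∣p-x∣ (to-∈ ι x∈p)) ⟩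
    ∣ q ∣                 ∎
    where
    open ≤-Reasoning
    ∣p-x∣≡k : ∣ p - x ∣ ≡ k
    ∣p-x∣≡k = suc-injective (trans (sym (x∈p⇒∣p∣≡1+∣p-x∣ x∈p)) ∣p∣≡1+k)

≢-≢⇒≡ : ∀ {x y z : Bool} → x ≢ y → y ≢ z → x ≡ z
≢-≢⇒≡ {x} {y} {z} x≢y y≢z = begin
  x            ≡⟨ ¬-not x≢y ⟩
  not y        ≡⟨ cong not (¬-not y≢z) ⟩
  not (not z)  ≡⟨ not-involutive z ⟩
  z            ∎
  where open ≡-Reasoning

¬¬-decidable : (_∼_ : Rel (Fin n) 0ℓ) → ¬ ¬ Decidable _∼_
¬¬-decidable _∼_ = sequence ¬¬-applicative λ x → sequence ¬¬-applicative λ y → ¬¬-excluded-middle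
  where
  ¬¬-applicative : RawApplicative {0ℓ} DoubleNegation
  ¬¬-applicative = RawMonad.rawApplicative ¬¬-Monad

module TreeOrder {_≼_ : Rel (Fin n) 0ℓ} (isPO : IsPartialOrder _≡_ _≼_) where

  open IsPartialOrder isPO using () renaming (refl to ≼-refl; trans to ≼-trans)

  private
    _<_ : Rel (Fin n) 0ℓ
    _<_ = _≺_ _≼_

    <-trans : ∀ {x y z} → x < y → y < z → x < z
    <-trans = ToStrict.<-trans _≡_ _≼_ isPO

    <-wellFounded : WellFounded _<_
    <-wellFounded = po-wellFounded isPO

  root-minimal : ∀ {r} → (∀ x → x ≢ r → CoversExactlyOne _≼_ x) → ∀ v → ¬ v < r
  root-minimal {r} non-root v = go (<-wellFounded v)
    where
    go : ∀ {v} → Acc _<_ v → ¬ v < r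
    go {v} (acc rec) v<r with non-root v (proj₂ v<r)
    ... | u , (u<v , _) , _ = go (rec u<v) (<-trans u<v v<r)

  covers-unique : IsTree _≼_ → ∀ {m v w} → Covers _≼_ m v → Covers _≼_ m w → v ≡ w
  covers-unique (inj₁ n≡0) {v = v} _ _ = contradiction (subst Fin n≡0 v) ¬Fin0
  covers-unique (inj₂ (r , non-root)) {m} {v} {w} m⋗v m⋗w with m ≟F r
  ... | yes refl = contradiction (proj₁ m⋗v) (root-minimal non-root v)
  ... | no m≢r with non-root m m≢r
  ... | _ , _ , unique = trans (unique v m⋗v) (sym (unique w m⋗w))

  DownSet : Subset n → Set
  DownSet S = ∀ {x y} → x ∈ S → y ≼ x → y ∈ S

  DownSet-remove-maximal : ∀ {S x} → DownSet S → Maximal _≼_ S x → DownSet (S - x)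
  DownSet-remove-maximal {S} {x} down (_ , x-max) {z} {y} z∈S-x y≼z =
    x∈p∧x≢y⇒x∈p-y (down z∈S y≼z) λ { refl → x-max z z∈S (y≼z , λ y≡z → x∈p-y⇒x≢y z∈S-x (sym y≡z)) }
    where
    z∈S : z ∈ S
    z∈S = p─q⊆p S _ z∈S-x

  module _ (_≼?_ : Decidable _≼_) where

    private
      _<?_ : Decidable _<_
      _<?_ = ToStrict.<-decidable _≡_ _≼_ _≟F_ _≼?_

    cover-below : ∀ {v w} → v < w → Σ (Fin n) λ m → Covers _≼_ m v × m ≼ w
    cover-below {v} {w} = go (<-wellFounded w)
      where
      go : ∀ {w} → Acc _<_ w → v < w → Σ (Fin n) λ m → Covers _≼_ m v × m ≼ w
      go {w} (acc rec) v<w with any? (λ z → (v <? z) ×-dec (z <? w))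
      ... | no nothing-between = w , (v<w , nothing-between) , ≼-refl
      ... | yes (z , v<z , z<w) with go (rec z<w) v<z
      ...   | m , m⋗v , m≼z = m , m⋗v , ≼-trans m≼z (proj₁ z<w)

    upper-cover : ∀ {S v} → DownSet S → v ∈ S → ¬ Maximal _≼_ S v →
                  Σ (Fin n) λ m → m ∈ S × Covers _≼_ m v
    upper-cover {S} {v} down v∈S v-not-max with any? (λ w → (w ∈? S) ×-dec (v <? w))
    ... | no nothing-above = contradiction (v∈S , λ w w∈S v<w → nothing-above (w , w∈S , v<w)) v-not-max
    ... | yes (w , w∈S , v<w) with cover-below v<w
    ...   | m , m⋗v , m≼w = m , down w∈S m≼w , m⋗v

module ChessTree {_≼_ : Rel (Fin n) 0ℓ} (isPO : IsPartialOrder _≡_ _≼_) (tree : IsTree _≼_)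
                 {col : Fin n → Bool} (chess : IsChess _≼_ col) where

  open TreeOrder isPO

  color-majority : Decidable _≼_ → ∀ {S c} → DownSet S → AllMaxOfColor _≼_ col S c →
                   ∣ S ∣ ≤ 2 * ∣ S ∩ ColorSet _≼_ col c ∣
  color-majority _≼?_ {S} {c} down all-max-c = begin
    ∣ S ∣                                ≡⟨ ∣p∣≡∣p∩q∣+∣p∩∁q∣ S C ⟩
    ∣ S ∩ C ∣ + ∣ S ∩ ∁ C ∣              ≤⟨ +-monoʳ-≤ ∣ S ∩ C ∣ (SubsetInjection⇒∣p∣≤∣q∣ upper-cover-injection) ⟩
    ∣ S ∩ C ∣ + ∣ S ∩ C ∣                ≡⟨ cong (∣ S ∩ C ∣ +_) (sym (+-identityʳ ∣ S ∩ C ∣)) ⟩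
    2 * ∣ S ∩ C ∣                        ∎
    where
    open ≤-Reasoning
    C : Subset n
    C = ColorSet _≼_ col c

    c∈C : ∀ {v} → col v ≡ c → v ∈ C
    c∈C {v} col-v≡c = x∈tabulate⁺ _ (dec-true (col v ≟B c) col-v≡c)

    col≢c : ∀ {v} → v ∈ S ∩ ∁ C → col v ≢ c
    col≢c v∈S∖C col-v≡c = x∈∁p⇒x∉p (proj₂ (x∈p∩q⁻ S (∁ C) v∈S∖C)) (c∈C col-v≡c)

    upper : ∀ {v} → v ∈ S ∩ ∁ C → Σ (Fin n) λ m → m ∈ S × Covers _≼_ m v
    upper v∈S∖C = upper-cover _≼?_ down (proj₁ (x∈p∩q⁻ S (∁ C) v∈S∖C))
                    (λ v-max → col≢c v∈S∖C (all-max-c _ v-max))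

    upper-cover-injection : SubsetInjection (S ∩ ∁ C) (S ∩ C)
    upper-cover-injection = record
      { to        = λ v∈S∖C → proj₁ (upper v∈S∖C)
      ; to-∈      = upper∈S∩C
      ; injective = upper-injective
      }
      where
      upper∈S∩C : ∀ {v} (v∈S∖C : v ∈ S ∩ ∁ C) → proj₁ (upper v∈S∖C) ∈ S ∩ C
      upper∈S∩C {v} v∈S∖C with upper v∈S∖C
      ... | m , m∈S , m⋗v = x∈p∩q⁺ (m∈S , c∈C (≢-≢⇒≡ (chess m v m⋗v) (col≢c v∈S∖C)))

      upper-injective : ∀ {v w} (v∈S∖C : v ∈ S ∩ ∁ C) (w∈S∖C : w ∈ S ∩ ∁ C) →
                        proj₁ (upper v∈S∖C) ≡ proj₁ (upper w∈S∖C) → v ≡ w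
      upper-injective v∈S∖C w∈S∖C same-cover with upper v∈S∖C | upper w∈S∖C
      upper-injective _ _ refl | m , _ , m⋗v | .m , _ , m⋗w = covers-unique tree m⋗v m⋗w

  -- _≼_ need not be decidable, but the bound on ∣ S ∣ is a decidable
  -- statement about ℕ, so it may be proved assuming decidability of _≼_.
  downSet-balanced : ∀ {S} → DownSet S → Balanced _≼_ col S
  downSet-balanced {S} = go (wellFounded-on ∣_∣ <ℕ-wellFounded S)
    where
    go : ∀ {S} → Acc (_<ℕ_ on ∣_∣) S → DownSet S → Balanced _≼_ col S
    go {S} (acc rec) down = balanced
      (λ x x-max → go (rec (x∈p⇒∣p-x∣<∣p∣ (proj₁ x-max))) (DownSet-remove-maximal down x-max))
      (λ c all-max-c → decidable-stable (∣ S ∣ ≤? 2 * ∣ S ∩ ColorSet _≼_ col c ∣)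
         (¬¬-map (λ _≼?_ → color-majority _≼?_ down all-max-c) (¬¬-decidable _≼_)))

mainTheorem3 : (n : ℕ) (_≼_ : Rel (Fin n) 0ℓ) → IsPartialOrder _≡_ _≼_ →
               (col : Fin n → Bool) → IsTree _≼_ → IsChess _≼_ col →
               BalancedPoset _≼_ col
mainTheorem3 n _≼_ isPO col tree chess = downSet-balanced (λ _ _ → ∈⊤)
  where open ChessTree isPO tree chess
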